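{- Let $D=(V,A)$ be a loopless digraph with minimum in-degree at least $1$, and let $\mathcal{L}D=\mathcal{L}_{(A',\phi)}D$ be a partial line digraph of $D$. Then the number of semikernels of $D$ is less than or equal to the number of semikernels of $\mathcal{L}D$.
   Context: For $U\subseteq V$, $\omega^-(U)=\{(x,y)\in A: y\in U, x\notin U\}$ and $\omega^+(U)=\{(x,y)\in A: x\in U, y\notin U\}$; $\omega^-(x)$ is the set of arcs with terminal vertex $x$. A set $S$ is independent if no arc joins two of its vertices. A semikernel of a digraph is an independent set $S$ such that for every arc $(s,x)\in\omega^+(S)$ there is an arc $(x,s')\in\omega^-(S)$. For a set of arcs $\Omega$, $H(\Omega)=\{y:(x,y)\in\Omega\}$. An arc $(i,j)$ is written $ij$. Partial line digraph: take $A'\subseteq A$ and a surjective map $\phi:A\to A'$ such that (i) $H(A')=V$; (ii) $\phi|_{A'}$ is the identity, and for every $j\in V$, $\phi(\omega^-(j))\subseteq\omega^-(j)\cap A'$. Then $\mathcal{L}_{(A',\phi)}D$ has vertex set $A'$ and arc set $\{(ij,\phi(jk)): ij\in A',\ (j,k)\in A\}$. -}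

module Defs where

open import Data.Bool using (Bool; true; false; T; _∧_; T?)
open import Data.Nat using (ℕ; zero; suc)
open import Data.Fin using (Fin; _≟_)
open import Data.Fin.Properties using (all?; any?)
open import Data.Fin.Subset using (Subset; _∈_; _∉_; inside; outside)
open import Data.Fin.Subset.Properties using (_∈?_)
open import Data.List using (List; []; _∷_; _++_; map; filter; length; lookup; cartesianProduct; allFin)
open import Data.Bool.ListAction using (any)
open import Data.Vec using (_∷_; [])
open import Data.Product using (Σ; ∃; _×_; _,_; proj₁; proj₂)
open import Data.Product.Properties using (≡-dec)
open import Relation.Nullary using (¬_; Dec; yes; no; ¬?)
open import Relation.Nullary.Decidable using (_×-dec_; _→-dec_; ⌊_⌋)
open import Relation.Binary.PropositionalEquality using (_≡_)

record Digraph : Set where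
  field
    size : ℕ
    adj  : Fin size → Fin size → Bool

open Digraph public

Arc : (G : Digraph) → Fin (size G) → Fin (size G) → Set
Arc G x y = T (adj G x y)

Independent : (G : Digraph) → Subset (size G) → Set
Independent G S = ∀ x y → x ∈ S → y ∈ S → ¬ Arc G x y

Semikernel : (G : Digraph) → Subset (size G) → Set
Semikernel G S =
  Independent G S ×
  (∀ s x → s ∈ S → x ∉ S → Arc G s x → ∃ λ s' → s' ∈ S × Arc G x s')

semikernel? : (G : Digraph) → (S : Subset (size G)) → Dec (Semikernel G S)
semikernel? G S = ind? ×-dec dom?
  where
  ind? = all? λ x → all? λ y → (x ∈? S) →-dec ((y ∈? S) →-dec ¬? (T? (adj G x y)))
  dom? = all? λ s → all? λ x → (s ∈? S) →-dec (¬? (x ∈? S) →-dec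
           (T? (adj G s x) →-dec any? λ s' → (s' ∈? S) ×-dec T? (adj G x s')))

allSubsets : ∀ m → List (Subset m)
allSubsets zero = [] ∷ []
allSubsets (suc m) = map (inside ∷_) (allSubsets m) ++ map (outside ∷_) (allSubsets m)

numSemikernels : Digraph → ℕ
numSemikernels G = length (filter (semikernel? G) (allSubsets (size G)))

-- Partial line digraph L_(A',φ) D of D = (Fin n, adj).
-- A' is given by its indicator A' : Fin n × Fin n → Bool, and
-- φ : Fin n × Fin n → Fin n × Fin n (only its values on arcs of D matter).

allPairs : ∀ n → List (Fin n × Fin n)
allPairs n = cartesianProduct (allFin n) (allFin n)

arcsA' : ∀ n → (Fin n × Fin n → Bool) → List (Fin n × Fin n)
arcsA' n A' = filter (λ p → T? (A' p)) (allPairs n)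

-- vertex set A' (vertex k is the k-th arc of A'); arc from ij to
-- φ(jk) for every arc (j , k) of D.
lineDigraph : ∀ n → (Fin n → Fin n → Bool) → (Fin n × Fin n → Bool)
            → (Fin n × Fin n → Fin n × Fin n) → Digraph
lineDigraph n adjD A' φ = record
  { size = length (arcsA' n A')
  ; adj  = λ u v →
      any (λ k → adjD (proj₂ (vtx u)) k
                 ∧ ⌊ ≡-dec _≟_ _≟_ (φ (proj₂ (vtx u) , k)) (vtx v) ⌋)
          (allFin n)
  }
  where
  vtx = lookup (arcsA' n A')

digraph : ∀ n → (Fin n → Fin n → Bool) → Digraph
digraph n a = record { size = n ; adj = a }

-- Send a semikernel S of D to the set of vertices ij of LD with j ∈ S.  The
-- head map ij ↦ j is a digraph homomorphism LD → D, and φ lets every arc jk of D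
-- be followed from any vertex ij of LD; these two facts make preimages of
-- semikernels semikernels.  Since H(A') = V the head map is surjective, so taking
-- preimages is injective on subsets, which gives the inequality.
module Submission where

open import Defs
open import Data.Empty using (⊥-elim)
open import Data.Bool using (Bool; T; T?)
open import Data.Bool.Properties using (T-∧)
open import Data.Nat using (ℕ; _≤_)
import Data.Nat as ℕ
open import Data.Nat.Properties using (module ≤-Reasoning)
open import Data.Fin using (Fin; zero; suc)
open import Data.Fin.Properties using (injective⇒≤)
open import Data.Fin.Subset using (Subset; _∈_; _∉_; _⊆_; inside; outside)
open import Data.Fin.Subset.Properties using (⊆-antisym)
open import Data.Product using (∃; _×_; _,_; proj₁; proj₂)
open import Data.List using (List; []; _∷_; map; filter; length; lookup; allFin)
open import Data.List.Properties using (length-map)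
open import Data.List.Relation.Unary.Any as Any using (here)
open import Data.List.Relation.Unary.Any.Properties using (any⁺; any⁻; lookup-index)
open import Data.List.Relation.Unary.All as All using (All)
open import Data.List.Relation.Unary.AllPairs using ([]; _∷_)
open import Data.List.Relation.Unary.Unique.Propositional using (Unique)
import Data.List.Relation.Unary.Unique.Propositional.Properties as Unique
open import Data.List.Relation.Binary.Subset.Propositional using () renaming (_⊆_ to _⊆ₗ_)
open import Data.List.Membership.Propositional using () renaming (_∈_ to _∈ₗ_)
open import Data.List.Membership.Propositional.Properties
  using (∈-lookup; ∈-map⁺; ∈-map⁻; ∈-++⁺ˡ; ∈-++⁺ʳ; ∈-filter⁺; ∈-filter⁻; ∈-cartesianProduct⁺; ∈-allFin)
import Data.List.Membership.Setoid.Properties as Membershipₛ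
open import Data.Vec using (_∷_; []; tabulate) renaming (lookup to vlookup)
open import Data.Vec.Properties using (∷-injectiveʳ; []=⇒lookup; lookup⇒[]=; lookup∘tabulate)
open import Function using (_∘_; Injective; Equivalence)
open import Relation.Nullary using (¬_)
open import Relation.Nullary.Decidable using (toWitness; fromWitness)
open import Relation.Binary.PropositionalEquality
  using (_≡_; refl; sym; trans; cong; subst; setoid)

private
  variable
    A : Set
    m n : ℕ

lookup-injective : {xs : List A} → Unique xs → {i j : Fin (length xs)}
                 → lookup xs i ≡ lookup xs j → i ≡ j
lookup-injective {xs = _ ∷ _} _          {zero}  {zero}  _ = refl
lookup-injective {xs = _ ∷ _} (x≢xs ∷ _) {zero}  {suc j} e = ⊥-elim (All.lookup x≢xs (∈-lookup j) e)
lookup-injective {xs = _ ∷ _} (x≢xs ∷ _) {suc i} {zero}  e = ⊥-elim (All.lookup x≢xs (∈-lookup i) (sym e))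
lookup-injective {xs = _ ∷ _} (_ ∷ uniq) {suc i} {suc j} e = cong suc (lookup-injective uniq e)

Unique-⊆⇒length≤ : {xs ys : List A} → Unique xs → xs ⊆ₗ ys → length xs ≤ length ys
Unique-⊆⇒length≤ {xs = xs} {ys} uniq xs⊆ys = injective⇒≤ position-injective
  where
  position : Fin (length xs) → Fin (length ys)
  position i = Any.index (xs⊆ys (∈-lookup i))

  position-injective : Injective _≡_ _≡_ position
  position-injective {i} {j} eq = lookup-injective uniq
    (Membershipₛ.index-injective (setoid _) (xs⊆ys (∈-lookup i)) (xs⊆ys (∈-lookup j)) eq)

allSubsets-complete : (S : Subset n) → S ∈ₗ allSubsets n
allSubsets-complete []            = here refl
allSubsets-complete (inside ∷ S)  = ∈-++⁺ˡ (∈-map⁺ (inside ∷_) (allSubsets-complete S))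
allSubsets-complete (outside ∷ S) =
  ∈-++⁺ʳ (map (inside ∷_) (allSubsets _)) (∈-map⁺ (outside ∷_) (allSubsets-complete S))

allSubsets-unique : ∀ n → Unique (allSubsets n)
allSubsets-unique ℕ.zero    = All.[] ∷ []
allSubsets-unique (ℕ.suc n) = Unique.++⁺ (Unique.map⁺ ∷-injectiveʳ (allSubsets-unique n))
                                       (Unique.map⁺ ∷-injectiveʳ (allSubsets-unique n))
                                       inside≢outside
  where
  inside≢outside : ∀ {S} → ¬ (S ∈ₗ map (inside ∷_) (allSubsets n) × S ∈ₗ map (outside ∷_) (allSubsets n))
  inside≢outside (p , q) with ∈-map⁻ (inside ∷_) p | ∈-map⁻ (outside ∷_) q
  ... | _ , _ , refl | _ , _ , ()

numSemikernels-mono : (G H : Digraph) (f : Subset (size G) → Subset (size H))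
                    → Injective _≡_ _≡_ f
                    → (∀ S → Semikernel G S → Semikernel H (f S))
                    → numSemikernels G ≤ numSemikernels H
numSemikernels-mono G H f f-injective f-preserves = begin
  numSemikernels G            ≡⟨ length-map f semikernelsG ⟨
  length (map f semikernelsG) ≤⟨ Unique-⊆⇒length≤ unique image⊆ ⟩
  numSemikernels H            ∎
  where
  open ≤-Reasoning
  semikernelsG : List (Subset (size G))
  semikernelsG = filter (semikernel? G) (allSubsets (size G))

  unique : Unique (map f semikernelsG)
  unique = Unique.map⁺ f-injective (Unique.filter⁺ (semikernel? G) (allSubsets-unique (size G)))

  image⊆ : map f semikernelsG ⊆ₗ filter (semikernel? H) (allSubsets (size H))
  image⊆ fS∈ with ∈-map⁻ f fS∈
  ... | S , S∈ , refl = ∈-filter⁺ (semikernel? H) (allSubsets-complete (f S))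
    (f-preserves S (proj₂ (∈-filter⁻ (semikernel? G) {xs = allSubsets (size G)} S∈)))

pullback : (Fin m → Fin n) → Subset n → Subset m
pullback h S = tabulate (vlookup S ∘ h)

∈-pullback⁺ : ∀ {h : Fin m → Fin n} {S k} → h k ∈ S → k ∈ pullback h S
∈-pullback⁺ {k = k} hk∈S = lookup⇒[]= k _ (trans (lookup∘tabulate _ k) ([]=⇒lookup hk∈S))

∈-pullback⁻ : ∀ {h : Fin m → Fin n} {S k} → k ∈ pullback h S → h k ∈ S
∈-pullback⁻ {S = S} {k} k∈ = lookup⇒[]= _ S (trans (sym (lookup∘tabulate _ k)) ([]=⇒lookup k∈))

pullback-reflects-⊆ : ∀ {h : Fin m → Fin n} → (∀ j → ∃ λ k → h k ≡ j)
                    → ∀ {S S'} → pullback h S ⊆ pullback h S' → S ⊆ S'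
pullback-reflects-⊆ surjective hS⊆hS' {j} j∈S with surjective j
... | k , refl = ∈-pullback⁻ (hS⊆hS' (∈-pullback⁺ j∈S))

pullback-injective : ∀ {h : Fin m → Fin n} → (∀ j → ∃ λ k → h k ≡ j)
                   → Injective _≡_ _≡_ (pullback h)
pullback-injective surjective eq =
  ⊆-antisym (pullback-reflects-⊆ surjective (subst (_ ∈_) eq))
            (pullback-reflects-⊆ surjective (subst (_ ∈_) (sym eq)))

Homomorphism : (H G : Digraph) → (Fin (size H) → Fin (size G)) → Set
Homomorphism H G h = ∀ u v → Arc H u v → Arc G (h u) (h v)

LocallyOutSurjective : (H G : Digraph) → (Fin (size H) → Fin (size G)) → Set
LocallyOutSurjective H G h = ∀ u j → Arc G (h u) j → ∃ λ v → h v ≡ j × Arc H u v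

Semikernel-pullback : (G H : Digraph) (h : Fin (size H) → Fin (size G))
                    → Homomorphism H G h → LocallyOutSurjective H G h
                    → ∀ S → Semikernel G S → Semikernel H (pullback h S)
Semikernel-pullback G H h hom lift S (independent , absorbs) = independent′ , absorbs′
  where
  independent′ : Independent H (pullback h S)
  independent′ u v u∈ v∈ uv = independent _ _ (∈-pullback⁻ u∈) (∈-pullback⁻ v∈) (hom u v uv)

  absorbs′ : ∀ s x → s ∈ pullback h S → x ∉ pullback h S → Arc H s x
           → ∃ λ s' → s' ∈ pullback h S × Arc H x s'
  absorbs′ s x s∈ x∉ sx with absorbs _ _ (∈-pullback⁻ s∈) (x∉ ∘ ∈-pullback⁺) (hom s x sx)
  ... | t , t∈S , hx-t with lift x t hx-t
  ... | s' , refl , xs' = s' , ∈-pullback⁺ t∈S , xs'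

module PartialLineDigraph (n : ℕ) (adj : Fin n → Fin n → Bool)
                          (A' : Fin n × Fin n → Bool) (φ : Fin n × Fin n → Fin n × Fin n) where

  D L : Digraph
  D = digraph n adj
  L = lineDigraph n adj A' φ

  arc : Fin (size L) → Fin n × Fin n
  arc = lookup (arcsA' n A')

  head : Fin (size L) → Fin n
  head = proj₂ ∘ arc

  arc-surjective : ∀ p → T (A' p) → ∃ λ u → arc u ≡ p
  arc-surjective (i , j) ij∈A' = Any.index ij∈ , sym (lookup-index ij∈)
    where
    ij∈ : (i , j) ∈ₗ arcsA' n A'
    ij∈ = ∈-filter⁺ (T? ∘ A') (∈-cartesianProduct⁺ (∈-allFin i) (∈-allFin j)) ij∈A'

  head-surjective : (∀ j → ∃ λ i → T (A' (i , j))) → ∀ j → ∃ λ u → head u ≡ j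
  head-surjective H[A']≡V j with H[A']≡V j
  ... | i , ij∈A' with arc-surjective (i , j) ij∈A'
  ... | u , refl = u , refl

  Arc-L⁻ : ∀ u v → Arc L u v → ∃ λ k → Arc D (head u) k × φ (head u , k) ≡ arc v
  Arc-L⁻ u v uv with Any.satisfied (any⁻ _ (allFin n) uv)
  ... | k , t with Equivalence.to T-∧ t
  ... | hu-k , φ≡v = k , hu-k , toWitness φ≡v

  Arc-L⁺ : ∀ u v k → Arc D (head u) k → φ (head u , k) ≡ arc v → Arc L u v
  Arc-L⁺ u v k hu-k φ≡v =
    any⁺ _ (Any.map (λ { refl → Equivalence.from T-∧ (hu-k , fromWitness φ≡v) }) (∈-allFin k))

  module _ (φ-arc : ∀ i j → T (adj i j) → proj₂ (φ (i , j)) ≡ j × T (A' (φ (i , j)))) where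

    head-homomorphism : Homomorphism L D head
    head-homomorphism u v uv with Arc-L⁻ u v uv
    ... | k , hu-k , φ≡v = subst (Arc D (head u)) k≡head-v hu-k
      where
      k≡head-v : k ≡ head v
      k≡head-v = trans (sym (proj₁ (φ-arc _ k hu-k))) (cong proj₂ φ≡v)

    head-locallyOutSurjective : LocallyOutSurjective L D head
    head-locallyOutSurjective u j hu-j with arc-surjective _ (proj₂ (φ-arc _ j hu-j))
    ... | v , v≡φ = v , trans (cong proj₂ v≡φ) (proj₁ (φ-arc _ j hu-j)) , Arc-L⁺ u v j hu-j (sym v≡φ)

theorem2p6 : (n : ℕ) (adj : Fin n → Fin n → Bool)
    → (∀ i → ¬ T (adj i i))
    → (∀ j → ∃ λ i → T (adj i j))
    → (A' : Fin n × Fin n → Bool) (φ : Fin n × Fin n → Fin n × Fin n)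
    → (∀ i j → T (A' (i , j)) → T (adj i j))
    → (∀ j → ∃ λ i → T (A' (i , j)))
    → (∀ p → T (A' p) → ∃ λ i → ∃ λ j → T (adj i j) × φ (i , j) ≡ p)
    → (∀ p → T (A' p) → φ p ≡ p)
    → (∀ i j → T (adj i j) → proj₂ (φ (i , j)) ≡ j × T (A' (φ (i , j))))
    → numSemikernels (digraph n adj)
        ≤ numSemikernels (lineDigraph n adj A' φ)
theorem2p6 n adj _ _ A' φ _ H[A']≡V _ _ φ-arc =
  numSemikernels-mono D L (pullback head) (pullback-injective (head-surjective H[A']≡V))
    (Semikernel-pullback D L head (head-homomorphism φ-arc) (head-locallyOutSurjective φ-arc))
  where open PartialLineDigraph n adj A' φ
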